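{- Let $Av_n(132)$ be the set of permutations of $[n]$ avoiding the pattern $132$, and let $\mathcal{S}_n$ be the set of sequences $s_1 s_2\cdots s_n$ of positive integers such that $s_i - s_{i+1} \le 1$ for all $i\in[n-1]$ and $s_n = 1$. For $p=p_1\cdots p_n\in Av_n(132)$ let $R(p) = r(p_1) r(p_2)\cdots r(p_n)$, where $r(p_i)$ is the maximal length of an increasing subsequence of $p$ beginning at $p_i$. Then $R$ maps $Av_n(132)$ into $\mathcal{S}_n$ and $R : Av_n(132) \to \mathcal{S}_n$ is a bijection.
   Context: A permutation $p=p_1\cdots p_n$ avoids $132$ if there are no indices $a<b<c$ with $p_a<p_c<p_b$. An increasing subsequence of $p$ is a sequence of entries $p_{j_1}<\cdots<p_{j_k}$ with $j_1<\cdots<j_k$; it begins at $p_{j_1}$. The number $r(p_i)$ is called the rank of $p_i$. -}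

module Defs where

open import Data.Nat using (ℕ; zero; suc; _≤_)
open import Data.Fin using (Fin; toℕ; _<_)
import Data.Fin as F
open import Data.Fin.Permutation using (Permutation′; _⟨$⟩ʳ_)
open import Data.Product using (Σ; _×_; ∃)
open import Relation.Binary.PropositionalEquality using (_≡_)
open import Relation.Nullary using (¬_)
open import Data.Empty using (⊥)

-- Permutations of [n] are bijections Fin n ↔ Fin n (values 0..n-1, order-isomorphic to [n]).

Avoids132 : {n : ℕ} → Permutation′ n → Set
Avoids132 {n} p = ¬ (Σ (Fin n) λ a → Σ (Fin n) λ b → Σ (Fin n) λ c →
  a < b × b < c × (p ⟨$⟩ʳ a) < (p ⟨$⟩ʳ c) × (p ⟨$⟩ʳ c) < (p ⟨$⟩ʳ b))

-- An increasing subsequence of p of length (suc m) beginning at p_i: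
-- positions js 0 < js 1 < ... < js m with increasing values and js 0 = i.
IncSubseqFrom : {n : ℕ} → Permutation′ n → Fin n → ℕ → Set
IncSubseqFrom {n} p i m = Σ (Fin (suc m) → Fin n) λ js →
  (js F.zero ≡ i) ×
  (∀ a b → a < b → js a < js b) ×
  (∀ a b → a < b → (p ⟨$⟩ʳ js a) < (p ⟨$⟩ʳ js b))

HasIncOfLength : {n : ℕ} → Permutation′ n → Fin n → ℕ → Set
HasIncOfLength p i zero = ⊥
HasIncOfLength p i (suc m) = IncSubseqFrom p i m

IsRank : {n : ℕ} → Permutation′ n → Fin n → ℕ → Set
IsRank p i k = HasIncOfLength p i k × (∀ l → HasIncOfLength p i l → l ≤ k)

IsRankSeq : {n : ℕ} → Permutation′ n → (Fin n → ℕ) → Set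
IsRankSeq p s = ∀ i → IsRank p i (s i)

InS : (n : ℕ) → (Fin n → ℕ) → Set
InS n s =
  (∀ i → 1 ≤ s i) ×
  (∀ i j → toℕ j ≡ suc (toℕ i) → s i ≤ suc (s j)) ×
  (∀ i → suc (toℕ i) ≡ n → s i ≡ 1)

module Submission where

-- For a 132-avoiding p with rank sequence s and positions i < j, p_i < p_j holds exactly
-- when s_j is below each of s_i, …, s_{j-1}.  Forward: every p_l in between lies below p_j
-- (otherwise p_i p_l p_j is a 132), so (l, j) is an ascent, and ranks drop along ascents.
-- Backward, for any p: if p_j < p_i, follow a longest increasing subsequence from p_i; its
-- ranks drop by one per step and its entries stay above p_j, so it reaches a rank ≤ s_j
-- before passing position j.  Thus s fixes the relative order of all entries of p, and the
-- same 132 argument shows s ∈ 𝒮_n.  Conversely, for s ∈ 𝒮_n this rule defines a strict total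
-- order on positions; ranking the positions by it gives a 132-avoider, in which walking right
-- from i to the first drop of s below s_i traces an increasing subsequence of length s_i.

open import Defs
open import Data.Bool using (if_then_else_)
open import Data.Empty using (⊥-elim)
open import Data.Fin as F using (Fin; toℕ; inject₁; punchOut) renaming (_<_ to _<ᶠ_; _≤_ to _≤ᶠ_)
open import Data.Fin.Induction using (<-weakInduction)
open import Data.Fin.Patterns using (0F; 1F)
open import Data.Fin.Permutation
  using (Permutation′; _⟨$⟩ʳ_; _⟨$⟩ˡ_; _≈_; permutation; inverseˡ; inverseʳ)
import Data.Fin.Properties as FP
open import Data.Fin.Subset using (Subset; inside; outside; _∈_; _⊂_; ∣_∣)
open import Data.Fin.Subset.Properties using (p⊂q⇒∣p∣<∣q∣; ⊆⊤; ∈⊤; ∣⊤∣≡n)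
open import Data.Nat using (ℕ; zero; suc; _≤_; _<_; _⊔_; _≤?_; z≤n; s≤s)
open import Data.Nat.Properties
open import Data.Product using (Σ; _×_; _,_; proj₁; proj₂; ∃)
open import Data.Sum using (_⊎_; inj₁; inj₂)
open import Data.Vec using (tabulate)
open import Data.Vec.Properties using (lookup∘tabulate; lookup⇒[]=; []=⇒lookup)
open import Function.Bundles using (_⇔_; mk⇔; Equivalence; Injection)
open import Function.Definitions using (Injective)
import Function.Properties.Equivalence as ⇔
open import Function.Properties.Inverse using (Inverse⇒Injection)
open import Level using (Level; 0ℓ)
open import Relation.Binary.Core using (Rel)
open import Relation.Binary.Definitions using (Decidable; Irreflexive; Transitive; tri<; tri≈; tri>)
open import Relation.Binary.PropositionalEquality
  using (_≡_; _≢_; refl; sym; trans; cong; subst; subst₂)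
open import Relation.Nullary using (¬_; Dec; yes; no; does)
open import Relation.Nullary.Decidable using (dec-true; _×-dec_; _⊎-dec_; _→-dec_; ¬?)
open import Relation.Unary using (Pred) renaming (Decidable to Decidable₁)

private variable
  n : ℕ
  ℓ : Level

permutation-injective : (π : Permutation′ n) → Injective _≡_ _≡_ (π ⟨$⟩ʳ_)
permutation-injective π = Injection.injective (Inverse⇒Injection π)

injective⇒surjective : (f : Fin n → Fin n) → Injective _≡_ _≡_ f → ∀ y → ∃ λ x → f x ≡ y
injective⇒surjective {suc m} f f-inj y with FP.any? (λ x → f x FP.≟ y)
... | yes hit = hit
... | no miss = ⊥-elim (n≮n m (FP.injective⇒≤ {f = avoid} avoid-injective))
  where
  avoid : Fin (suc m) → Fin m
  avoid x = punchOut {i = y} λ y≡fx → miss (x , sym y≡fx)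
  avoid-injective : Injective _≡_ _≡_ avoid
  avoid-injective {x} {x′} eq =
    f-inj (FP.punchOut-injective (λ e → miss (x , sym e)) (λ e → miss (x′ , sym e)) eq)

injective⇒permutation : (f : Fin n → Fin n) → Injective _≡_ _≡_ f →
  Σ (Permutation′ n) λ π → ∀ i → π ⟨$⟩ʳ i ≡ f i
injective⇒permutation f f-inj =
  permutation f (λ y → proj₁ (onto y)) (λ y → proj₂ (onto y)) (λ x → f-inj (proj₂ (onto (f x)))) ,
  λ _ → refl
  where
  onto : ∀ y → ∃ λ x → f x ≡ y
  onto = injective⇒surjective f f-inj

module _ {P : Pred (Fin n) ℓ} (P? : Decidable₁ P) where

  subset : Subset n
  subset = tabulate λ i → if does (P? i) then inside else outside

  ∈-subset⁺ : ∀ {i} → P i → i ∈ subset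
  ∈-subset⁺ {i} Pi = lookup⇒[]= i subset
    (trans (lookup∘tabulate _ i) (cong (if_then inside else outside) (dec-true (P? i) Pi)))

  ∈-subset⁻ : ∀ {i} → i ∈ subset → P i
  ∈-subset⁻ {i} i∈ = selected (P? i) (trans (sym (lookup∘tabulate _ i)) ([]=⇒lookup i∈))
    where
    selected : ∀ {A : Set ℓ} (d : Dec A) → (if does d then inside else outside) ≡ inside → A
    selected (yes a) _ = a

module _ {_≺_ : Rel (Fin n) ℓ} (≺? : Decidable _≺_)
         (irrefl : Irreflexive _≡_ _≺_) (≺-trans : Transitive _≺_) where

  below? : ∀ j → Decidable₁ (_≺ j)
  below? j i = ≺? i j

  predecessors : Fin n → Subset n
  predecessors j = subset (below? j)

  predecessors-⊂ : ∀ {i j} → i ≺ j → predecessors i ⊂ predecessors j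
  predecessors-⊂ i≺j =
    (λ k∈ → ∈-subset⁺ (below? _) (≺-trans (∈-subset⁻ (below? _) k∈) i≺j)) ,
    _ , ∈-subset⁺ (below? _) i≺j , λ i∈ → irrefl refl (∈-subset⁻ (below? _) i∈)

  predecessors-< : ∀ i → ∣ predecessors i ∣ < n
  predecessors-< i = subst (∣ predecessors i ∣ <_) (∣⊤∣≡n n)
    (p⊂q⇒∣p∣<∣q∣ (⊆⊤ , i , ∈⊤ , λ i∈ → irrefl refl (∈-subset⁻ (below? i) i∈)))

  height : Fin n → Fin n
  height i = F.fromℕ< (predecessors-< i)

  height-mono : ∀ {i j} → i ≺ j → height i <ᶠ height j
  height-mono i≺j = subst₂ _<_ (sym (FP.toℕ-fromℕ< _)) (sym (FP.toℕ-fromℕ< _))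
    (p⊂q⇒∣p∣<∣q∣ (predecessors-⊂ i≺j))

  module _ (connected : ∀ {i j} → i ≢ j → i ≺ j ⊎ j ≺ i) where

    height-injective : Injective _≡_ _≡_ height
    height-injective {i} {j} eq with i FP.≟ j
    ... | yes i≡j = i≡j
    ... | no i≢j with connected i≢j
    ...   | inj₁ i≺j = ⊥-elim (FP.<-irrefl eq (height-mono i≺j))
    ...   | inj₂ j≺i = ⊥-elim (FP.<-irrefl (sym eq) (height-mono j≺i))

    strictTotal⇒permutation : Σ (Permutation′ n) λ π → ∀ {i j} → i ≺ j → π ⟨$⟩ʳ i <ᶠ π ⟨$⟩ʳ j
    strictTotal⇒permutation =
      let π , π≗height = injective⇒permutation height height-injective in
      π , λ {i} {j} i≺j → subst₂ _<ᶠ_ (sym (π≗height i)) (sym (π≗height j)) (height-mono i≺j)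

increasing⇒inflationary : (g : Fin n → Fin n) → (∀ {a b} → a <ᶠ b → g a <ᶠ g b) → ∀ i → i ≤ᶠ g i
increasing⇒inflationary {suc _} g g-incr = <-weakInduction (λ i → i ≤ᶠ g i) z≤n step
  where
  step : ∀ j → inject₁ j ≤ᶠ g (inject₁ j) → F.suc j ≤ᶠ g (F.suc j)
  step j ih = ≤-<-trans (subst (_≤ toℕ (g (inject₁ j))) (FP.toℕ-inject₁ j) ih)
    (g-incr (s≤s (≤-reflexive (FP.toℕ-inject₁ j))))

SameAscents : Permutation′ n → Permutation′ n → Set
SameAscents π σ = ∀ {a b} → a <ᶠ b → (π ⟨$⟩ʳ a <ᶠ π ⟨$⟩ʳ b ⇔ σ ⟨$⟩ʳ a <ᶠ σ ⟨$⟩ʳ b)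

module _ {π σ : Permutation′ n} (same : SameAscents π σ) where

  sameAscents⇒sameOrder : ∀ {a b} → π ⟨$⟩ʳ a <ᶠ π ⟨$⟩ʳ b → σ ⟨$⟩ʳ a <ᶠ σ ⟨$⟩ʳ b
  sameAscents⇒sameOrder {a} {b} πa<πb with FP.<-cmp a b
  ... | tri< a<b _ _ = Equivalence.to (same a<b) πa<πb
  ... | tri≈ _ refl _ = ⊥-elim (FP.<-irrefl refl πa<πb)
  ... | tri> _ _ b<a with FP.<-cmp (σ ⟨$⟩ʳ a) (σ ⟨$⟩ʳ b)
  ...   | tri< σa<σb _ _ = σa<σb
  ...   | tri≈ _ σa≡σb _ = ⊥-elim (FP.<-irrefl (sym (permutation-injective σ σa≡σb)) b<a)
  ...   | tri> _ _ σb<σa = ⊥-elim (FP.<-asym πa<πb (Equivalence.from (same b<a) σb<σa))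

  sameAscents⇒≤ : ∀ i → π ⟨$⟩ʳ i ≤ᶠ σ ⟨$⟩ʳ i
  sameAscents⇒≤ i = subst (λ j → π ⟨$⟩ʳ i ≤ᶠ σ ⟨$⟩ʳ j) (inverseˡ π)
    (increasing⇒inflationary (λ y → σ ⟨$⟩ʳ (π ⟨$⟩ˡ y)) increasing (π ⟨$⟩ʳ i))
    where
    increasing : ∀ {a b} → a <ᶠ b → σ ⟨$⟩ʳ (π ⟨$⟩ˡ a) <ᶠ σ ⟨$⟩ʳ (π ⟨$⟩ˡ b)
    increasing a<b = sameAscents⇒sameOrder (subst₂ _<ᶠ_ (sym (inverseʳ π)) (sym (inverseʳ π)) a<b)

sameAscents⇒≈ : {π σ : Permutation′ n} → SameAscents π σ → π ≈ σ
sameAscents⇒≈ {π = π} {σ} same i = FP.toℕ-injective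
  (≤-antisym (sameAscents⇒≤ {π = π} {σ} same i)
             (sameAscents⇒≤ {π = σ} {π} (λ a<b → ⇔.sym (same a<b)) i))

minimal-counterexample : {P : Pred (Fin n) ℓ} → Decidable₁ P → ¬ (∀ i → P i) →
  ∃ λ j → ¬ P j × (∀ l → l <ᶠ j → P l)
minimal-counterexample {n} {P = P} P? ¬∀P with FP.¬∀⟶∃¬-smallest n P P? ¬∀P
... | j , ¬Pj , before = j , ¬Pj , λ l l<j → subst P (inject-fromℕ< l<j) (before (F.fromℕ< l<j))
  where
  inject-fromℕ< : ∀ {l} (l<j : toℕ l < toℕ j) → F.inject (F.fromℕ< l<j) ≡ l
  inject-fromℕ< l<j = FP.toℕ-injective (trans (FP.toℕ-inject _) (FP.toℕ-fromℕ< l<j))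

predecessor : ∀ {i j : Fin n} → i <ᶠ j → Σ (Fin n) λ k → toℕ j ≡ suc (toℕ k) × i ≤ᶠ k
predecessor {i = i} {F.suc k} (s≤s i≤k) =
  inject₁ k , cong suc (sym (FP.toℕ-inject₁ k)) , subst (toℕ i ≤_) (sym (FP.toℕ-inject₁ k)) i≤k

last-position : Fin n → Σ (Fin n) λ l → suc (toℕ l) ≡ n
last-position {suc m} _ = F.fromℕ m , cong suc (FP.toℕ-fromℕ m)

maximum : (Fin n → ℕ) → ℕ
maximum {zero} g = 0
maximum {suc n} g = g F.zero ⊔ maximum (λ i → g (F.suc i))

≤-maximum : (g : Fin n → ℕ) → ∀ i → g i ≤ maximum g
≤-maximum g F.zero = m≤m⊔n _ _
≤-maximum g (F.suc i) = ≤-trans (≤-maximum (λ i → g (F.suc i)) i) (m≤n⊔m _ _)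

maximum-attained : (g : Fin n → ℕ) → maximum g ≡ 0 ⊎ ∃ λ i → maximum g ≡ g i
maximum-attained {zero} g = inj₁ refl
maximum-attained {suc n} g with ⊔-sel (g F.zero) (maximum (λ i → g (F.suc i)))
... | inj₁ max≡g₀ = inj₂ (F.zero , max≡g₀)
... | inj₂ max≡rest with maximum-attained (λ i → g (F.suc i))
...   | inj₁ rest≡0 = inj₁ (trans max≡rest rest≡0)
...   | inj₂ (i , rest≡gi) = inj₂ (F.suc i , trans max≡rest rest≡gi)

NewMinimum : (Fin n → ℕ) → Fin n → Fin n → Set
NewMinimum s i j = ∀ l → i ≤ᶠ l → l <ᶠ j → s j < s l

module _ (s : Fin n → ℕ) where

  newMinimum? : Decidable (NewMinimum s)
  newMinimum? i j = FP.all? λ l → (i FP.≤? l) →-dec (l FP.<? j) →-dec (s j <? s l)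

  newMinimum-shrink : ∀ {i i′ j} → i ≤ᶠ i′ → NewMinimum s i j → NewMinimum s i′ j
  newMinimum-shrink i≤i′ newMin l i′≤l = newMin l (≤-trans i≤i′ i′≤l)

  newMinimum-trans : ∀ {i j k} → j <ᶠ k → NewMinimum s i j → NewMinimum s j k → NewMinimum s i k
  newMinimum-trans {j = j} j<k ij jk l i≤l l<k with l FP.<? j
  ... | yes l<j = <-trans (jk j ≤-refl j<k) (ij l i≤l l<j)
  ... | no l≮j = jk l (≮⇒≥ l≮j) l<k

first-drop : ∀ {s : Fin n → ℕ} → InS n s → ∀ {i} → 2 ≤ s i →
  ∃ λ j → i <ᶠ j × NewMinimum s i j × s i ≤ suc (s j)
first-drop {n} {s} (_ , step , last) {i} 2≤si = drop (minimal-counterexample stays? never-drops)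
  where
  Stays : Fin n → Set
  Stays l = l <ᶠ i ⊎ s i ≤ s l
  stays? : Decidable₁ Stays
  stays? l = (l FP.<? i) ⊎-dec (s i ≤? s l)
  never-drops : ¬ (∀ l → Stays l)
  never-drops all with last-position i
  ... | L , 1+L≡n with all L
  ...   | inj₁ L<i = <⇒≱ L<i (≤-pred (subst (toℕ i <_) (sym 1+L≡n) (FP.toℕ<n i)))
  ...   | inj₂ si≤sL = <⇒≱ 2≤si (subst (s i ≤_) (last L 1+L≡n) si≤sL)
  drop : (∃ λ j → ¬ Stays j × (∀ l → l <ᶠ j → Stays l)) →
    ∃ λ j → i <ᶠ j × NewMinimum s i j × s i ≤ suc (s j)
  drop (j , drops , before) = j , i<j , newMin , si≤
    where
    sj<si : s j < s i
    sj<si = ≰⇒> (λ si≤sj → drops (inj₂ si≤sj))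
    i<j : i <ᶠ j
    i<j = FP.≤∧≢⇒< (≮⇒≥ (λ j<i → drops (inj₁ j<i))) λ { refl → <-irrefl refl sj<si }
    newMin : NewMinimum s i j
    newMin l i≤l l<j with before l l<j
    ... | inj₁ l<i = ⊥-elim (<⇒≱ l<i i≤l)
    ... | inj₂ si≤sl = <-≤-trans sj<si si≤sl
    si≤ : s i ≤ suc (s j)
    si≤ with predecessor i<j
    ... | k , j≡1+k , i≤k with before k (≤-reflexive (sym j≡1+k))
    ...   | inj₁ k<i = ⊥-elim (<⇒≱ k<i i≤k)
    ...   | inj₂ si≤sk = ≤-trans si≤sk (step k j j≡1+k)

Ascent : Permutation′ n → Fin n → Fin n → Set
Ascent p i j = i <ᶠ j × p ⟨$⟩ʳ i <ᶠ p ⟨$⟩ʳ j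

module IncreasingSubsequences (p : Permutation′ n) where

  singleton : ∀ i → IncSubseqFrom p i 0
  singleton i = (λ _ → i) , refl , (λ { F.zero F.zero () }) , (λ { F.zero F.zero () })

  head-≤ : ∀ {m} (f : Fin (suc m) → Fin n) → (∀ a b → a <ᶠ b → f a <ᶠ f b) → ∀ b → f F.zero ≤ᶠ f b
  head-≤ f f-incr F.zero = ≤-refl
  head-≤ f f-incr (F.suc b) = <⇒≤ (f-incr F.zero (F.suc b) (s≤s z≤n))

  cons : ∀ {i j m} → Ascent p i j → IncSubseqFrom p j m → IncSubseqFrom p i (suc m)
  cons {i} {j} {m} (i<j , pi<pj) (js , refl , js-incr , pjs-incr) =
    js′ , refl , js′-incr , pjs′-incr
    where
    js′ : Fin (suc (suc m)) → Fin n
    js′ F.zero = i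
    js′ (F.suc a) = js a
    js′-incr : ∀ a b → a <ᶠ b → js′ a <ᶠ js′ b
    js′-incr F.zero (F.suc b) _ = <-≤-trans i<j (head-≤ js js-incr b)
    js′-incr (F.suc a) (F.suc b) (s≤s a<b) = js-incr a b a<b
    pjs′-incr : ∀ a b → a <ᶠ b → p ⟨$⟩ʳ js′ a <ᶠ p ⟨$⟩ʳ js′ b
    pjs′-incr F.zero (F.suc b) _ = <-≤-trans pi<pj (head-≤ (λ a → p ⟨$⟩ʳ js a) pjs-incr b)
    pjs′-incr (F.suc a) (F.suc b) (s≤s a<b) = pjs-incr a b a<b

  uncons : ∀ {i m} → IncSubseqFrom p i (suc m) → ∃ λ j → Ascent p i j × IncSubseqFrom p j m
  uncons (js , refl , js-incr , pjs-incr) =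
    js 1F , (js-incr 0F 1F (s≤s z≤n) , pjs-incr 0F 1F (s≤s z≤n)) ,
    (λ a → js (F.suc a)) , refl ,
    (λ a b a<b → js-incr (F.suc a) (F.suc b) (s≤s a<b)) ,
    (λ a b a<b → pjs-incr (F.suc a) (F.suc b) (s≤s a<b))

  length-≤ : ∀ {i m} → IncSubseqFrom p i m → suc m ≤ n
  length-≤ (js , _ , js-incr , _) = FP.injective⇒≤ {f = js} js-injective
    where
    js-injective : Injective _≡_ _≡_ js
    js-injective {a} {b} js-a≡js-b with FP.<-cmp a b
    ... | tri< a<b _ _ = ⊥-elim (FP.<-irrefl js-a≡js-b (js-incr a b a<b))
    ... | tri≈ _ a≡b _ = a≡b
    ... | tri> _ _ b<a = ⊥-elim (FP.<-irrefl (sym js-a≡js-b) (js-incr b a b<a))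

  ascent? : Decidable (Ascent p)
  ascent? i j = (i FP.<? j) ×-dec (p ⟨$⟩ʳ i FP.<? p ⟨$⟩ʳ j)

  longest : ℕ → Fin n → ℕ
  longest zero i = 0
  longest (suc f) i = maximum λ j → if does (ascent? i j) then suc (longest f j) else 0

  longest-realised : ∀ f i → IncSubseqFrom p i (longest f i)
  longest-realised zero i = singleton i
  longest-realised (suc f) i
    with maximum-attained (λ j → if does (ascent? i j) then suc (longest f j) else 0)
  ... | inj₁ max≡0 = subst (IncSubseqFrom p i) (sym max≡0) (singleton i)
  ... | inj₂ (j , max≡) = realise (ascent? i j) max≡
    where
    realise : ∀ {k} (d : Dec (Ascent p i j)) → k ≡ (if does d then suc (longest f j) else 0) →
      IncSubseqFrom p i k
    realise (yes asc) refl = cons asc (longest-realised f j)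
    realise (no _) refl = singleton i

  longest-maximal : ∀ f i {m} → IncSubseqFrom p i m → m ≤ f → m ≤ longest f i
  longest-maximal f i {zero} _ _ = z≤n
  longest-maximal (suc f) i {suc m} c (s≤s m≤f) with uncons c
  ... | j , asc , c′ = ≤-trans (extend (ascent? i j)) (≤-maximum _ j)
    where
    extend : (d : Dec (Ascent p i j)) → suc m ≤ (if does d then suc (longest f j) else 0)
    extend (yes _) = s≤s (longest-maximal f j c′ m≤f)
    extend (no ¬asc) = ⊥-elim (¬asc asc)

rankSeq-exists : (p : Permutation′ n) → Σ (Fin n → ℕ) (IsRankSeq p)
rankSeq-exists {n} p = (λ i → suc (longest n i)) , λ i →
  longest-realised n i ,
  λ { zero () ; (suc m) c → s≤s (longest-maximal n i c (≤-pred (m≤n⇒m≤1+n (length-≤ c)))) }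
  where open IncreasingSubsequences p

module RankSequence {p : Permutation′ n} {s : Fin n → ℕ} (rank : IsRankSeq p s) where
  open IncreasingSubsequences p

  rank-positive : ∀ i → 1 ≤ s i
  rank-positive i with s i | rank i
  ... | suc _ | _ = s≤s z≤n

  rank-ascent : ∀ {i j} → Ascent p i j → s j < s i
  rank-ascent {i} {j} asc with s j | rank j
  ... | suc m | c , _ = proj₂ (rank i) (suc (suc m)) (cons asc c)

  rank-next : ∀ {i} → 2 ≤ s i → ∃ λ j → Ascent p i j × s i ≤ suc (s j)
  rank-next {i} 2≤si with s i | rank i
  rank-next (s≤s (s≤s z≤n)) | suc (suc m) | c , _ with uncons c
  ... | j , asc , c′ = j , asc , s≤s (proj₂ (rank j) (suc m) c′)

  descent⇒rank-dip : ∀ {i j} → i <ᶠ j → p ⟨$⟩ʳ j <ᶠ p ⟨$⟩ʳ i →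
    ∃ λ l → i ≤ᶠ l × l <ᶠ j × s l ≤ s j
  descent⇒rank-dip {i} = go (s i) ≤-refl
    where
    go : ∀ k {i j} → s i ≤ k → i <ᶠ j → p ⟨$⟩ʳ j <ᶠ p ⟨$⟩ʳ i → ∃ λ l → i ≤ᶠ l × l <ᶠ j × s l ≤ s j
    go zero {i} si≤0 _ _ = ⊥-elim (<-irrefl refl (≤-trans (rank-positive i) si≤0))
    go (suc k) {i} {j} si≤k i<j pj<pi with s i ≤? 1
    ... | yes si≤1 = i , ≤-refl , i<j , ≤-trans si≤1 (rank-positive j)
    ... | no si≰1 with rank-next (≰⇒> si≰1)
    ... | b , (i<b , pi<pb) , si≤ with FP.<-cmp b j
    ...   | tri≈ _ refl _ = ⊥-elim (FP.<-asym pj<pi pi<pb)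
    ...   | tri> _ _ j<b =
      i , ≤-refl , i<j , ≤-trans si≤ (rank-ascent (j<b , FP.<-trans pj<pi pi<pb))
    ...   | tri< b<j _ _
      with go k (≤-pred (≤-trans (rank-ascent (i<b , pi<pb)) si≤k)) b<j (FP.<-trans pj<pi pi<pb)
    ...     | l , b≤l , l<j , sl≤sj = l , ≤-trans (<⇒≤ i<b) b≤l , l<j , sl≤sj

  newMinimum⇒ascent : ∀ {i j} → i <ᶠ j → NewMinimum s i j → p ⟨$⟩ʳ i <ᶠ p ⟨$⟩ʳ j
  newMinimum⇒ascent {i} {j} i<j newMin with FP.<-cmp (p ⟨$⟩ʳ i) (p ⟨$⟩ʳ j)
  ... | tri< pi<pj _ _ = pi<pj
  ... | tri≈ _ pi≡pj _ = ⊥-elim (FP.<-irrefl (permutation-injective p pi≡pj) i<j)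
  ... | tri> _ _ pj<pi with descent⇒rank-dip i<j pj<pi
  ...   | l , i≤l , l<j , sl≤sj = ⊥-elim (<⇒≱ (newMin l i≤l l<j) sl≤sj)

module _ {p : Permutation′ n} {s : Fin n → ℕ} where
  open IncreasingSubsequences p

  isRankSeq-intro : (∀ i → 1 ≤ s i) → (∀ {i j} → Ascent p i j → s j < s i) →
    (∀ {i} → 2 ≤ s i → ∃ λ j → Ascent p i j × s i ≤ suc (s j)) → IsRankSeq p s
  isRankSeq-intro positive decreasing next i with s i in si≡ | positive i
  ... | suc k | _ = realise k si≡ , λ { zero () ; (suc m) c → subst (suc m ≤_) si≡ (length<rank c) }
    where
    length<rank : ∀ {i m} → IncSubseqFrom p i m → m < s i
    length<rank {i} {zero} _ = positive i
    length<rank {i} {suc m} c with uncons c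
    ... | j , asc , c′ = ≤-trans (s≤s (length<rank c′)) (decreasing asc)
    realise : ∀ k {i} → s i ≡ suc k → IncSubseqFrom p i k
    realise zero _ = singleton _
    realise (suc k) si≡ with next (subst (2 ≤_) (sym si≡) (s≤s (s≤s z≤n)))
    ... | j , asc , si≤ = cons asc (realise k sj≡)
      where
      sj≡ : s j ≡ suc k
      sj≡ = ≤-antisym (≤-pred (subst (s j <_) si≡ (decreasing asc)))
                      (≤-pred (subst (_≤ suc (s j)) si≡ si≤))

module Avoider {p : Permutation′ n} (avoids : Avoids132 p) where

  middle<last : ∀ {a b c} → a <ᶠ b → b <ᶠ c → p ⟨$⟩ʳ a <ᶠ p ⟨$⟩ʳ c → p ⟨$⟩ʳ b <ᶠ p ⟨$⟩ʳ c
  middle<last {a} {b} {c} a<b b<c pa<pc with FP.<-cmp (p ⟨$⟩ʳ b) (p ⟨$⟩ʳ c)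
  ... | tri< pb<pc _ _ = pb<pc
  ... | tri≈ _ pb≡pc _ = ⊥-elim (FP.<-irrefl (permutation-injective p pb≡pc) b<c)
  ... | tri> _ _ pc<pb = ⊥-elim (avoids (a , b , c , a<b , b<c , pa<pc , pc<pb))

  module _ {s : Fin n → ℕ} (rank : IsRankSeq p s) where
    open RankSequence rank

    ascent⇔newMinimum : ∀ {i j} → i <ᶠ j → (p ⟨$⟩ʳ i <ᶠ p ⟨$⟩ʳ j ⇔ NewMinimum s i j)
    ascent⇔newMinimum {i} {j} i<j = mk⇔ ascent⇒newMinimum (newMinimum⇒ascent i<j)
      where
      ascent⇒newMinimum : p ⟨$⟩ʳ i <ᶠ p ⟨$⟩ʳ j → NewMinimum s i j
      ascent⇒newMinimum pi<pj l i≤l l<j with FP.<-cmp i l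
      ... | tri≈ _ refl _ = rank-ascent (i<j , pi<pj)
      ... | tri< i<l _ _ = rank-ascent (l<j , middle<last i<l l<j pi<pj)
      ... | tri> _ _ l<i = ⊥-elim (<⇒≱ l<i i≤l)

    rankSeq∈S : InS n s
    rankSeq∈S = rank-positive , step , last
      where
      step : ∀ i j → toℕ j ≡ suc (toℕ i) → s i ≤ suc (s j)
      step i j j≡1+i with s i ≤? 1
      ... | yes si≤1 = ≤-trans si≤1 (s≤s z≤n)
      ... | no si≰1 with rank-next (≰⇒> si≰1)
      ... | b , (i<b , pi<pb) , si≤ with FP.<-cmp j b
      ...   | tri≈ _ refl _ = si≤
      ...   | tri> _ _ b<j = ⊥-elim (<⇒≱ b<j (≤-trans (≤-reflexive j≡1+i) i<b))
      ...   | tri< j<b _ _ = ≤-trans si≤ (m≤n⇒m≤1+n (rank-ascent (j<b , pj<pb)))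
        where
        pj<pb : p ⟨$⟩ʳ j <ᶠ p ⟨$⟩ʳ b
        pj<pb = middle<last (≤-reflexive (sym j≡1+i)) j<b pi<pb
      last : ∀ i → suc (toℕ i) ≡ n → s i ≡ 1
      last i 1+i≡n with s i ≤? 1
      ... | yes si≤1 = ≤-antisym si≤1 (rank-positive i)
      ... | no si≰1 with rank-next (≰⇒> si≰1)
      ... | b , (i<b , _) , _ = ⊥-elim (<⇒≱ (FP.toℕ<n b) (subst (_≤ toℕ b) 1+i≡n i<b))

rankSeq-injective : {p q : Permutation′ n} {s : Fin n → ℕ} → Avoids132 p → Avoids132 q →
  IsRankSeq p s → IsRankSeq q s → p ≈ q
rankSeq-injective {p = p} {q} p-avoids q-avoids p-rank q-rank = sameAscents⇒≈ {π = p} {q} λ a<b →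
  ⇔.trans (Avoider.ascent⇔newMinimum p-avoids p-rank a<b)
          (⇔.sym (Avoider.ascent⇔newMinimum q-avoids q-rank a<b))

module Construction {s : Fin n → ℕ} (s∈S : InS n s) where

  -- The relative order that ascent⇔newMinimum forces on any preimage of s.
  _≺_ : Rel (Fin n) 0ℓ
  i ≺ j = (i <ᶠ j × NewMinimum s i j) ⊎ (j <ᶠ i × ¬ NewMinimum s j i)

  ≺? : Decidable _≺_
  ≺? i j = ((i FP.<? j) ×-dec newMinimum? s i j) ⊎-dec ((j FP.<? i) ×-dec ¬? (newMinimum? s j i))

  ≺-irrefl : Irreflexive _≡_ _≺_
  ≺-irrefl refl (inj₁ (i<i , _)) = <-irrefl refl i<i
  ≺-irrefl refl (inj₂ (i<i , _)) = <-irrefl refl i<i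

  ≺-trans : Transitive _≺_
  ≺-trans (inj₁ (i<j , ij)) (inj₁ (j<k , jk)) =
    inj₁ (<-trans i<j j<k , newMinimum-trans s j<k ij jk)
  ≺-trans {i} {j} {k} (inj₁ (i<j , ij)) (inj₂ (k<j , ¬kj)) with FP.<-cmp i k
  ... | tri< i<k _ _ = ⊥-elim (¬kj (newMinimum-shrink s (<⇒≤ i<k) ij))
  ... | tri≈ _ refl _ = ⊥-elim (¬kj ij)
  ... | tri> _ _ k<i = inj₂ (k<i , λ ki → ¬kj (newMinimum-trans s i<j ki ij))
  ≺-trans {i} {j} {k} (inj₂ (j<i , ¬ji)) (inj₁ (j<k , jk)) with FP.<-cmp i k
  ... | tri< i<k _ _ = inj₁ (i<k , newMinimum-shrink s (<⇒≤ j<i) jk)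
  ... | tri≈ _ refl _ = ⊥-elim (¬ji jk)
  ... | tri> _ _ k<i = inj₂ (k<i , λ ki → ¬ji (newMinimum-trans s k<i jk ki))
  ≺-trans (inj₂ (j<i , ¬ji)) (inj₂ (k<j , ¬kj)) =
    inj₂ (<-trans k<j j<i , λ ki → ¬ji (newMinimum-shrink s (<⇒≤ k<j) ki))

  ≺-connected : ∀ {i j} → i ≢ j → i ≺ j ⊎ j ≺ i
  ≺-connected {i} {j} i≢j with FP.<-cmp i j
  ... | tri≈ _ i≡j _ = ⊥-elim (i≢j i≡j)
  ... | tri< i<j _ _ with newMinimum? s i j
  ...   | yes ij = inj₁ (inj₁ (i<j , ij))
  ...   | no ¬ij = inj₂ (inj₂ (i<j , ¬ij))
  ≺-connected {i} {j} i≢j | tri> _ _ j<i with newMinimum? s j i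
  ...   | yes ji = inj₂ (inj₁ (j<i , ji))
  ...   | no ¬ji = inj₁ (inj₂ (j<i , ¬ji))

  π : Permutation′ n
  π = proj₁ (strictTotal⇒permutation ≺? ≺-irrefl ≺-trans ≺-connected)

  π-monotone : ∀ {i j} → i ≺ j → π ⟨$⟩ʳ i <ᶠ π ⟨$⟩ʳ j
  π-monotone = proj₂ (strictTotal⇒permutation ≺? ≺-irrefl ≺-trans ≺-connected)

  π-ascent⇔newMinimum : ∀ {i j} → i <ᶠ j → (π ⟨$⟩ʳ i <ᶠ π ⟨$⟩ʳ j ⇔ NewMinimum s i j)
  π-ascent⇔newMinimum {i} {j} i<j = mk⇔ ascent⇒newMinimum (λ ij → π-monotone (inj₁ (i<j , ij)))
    where
    ascent⇒newMinimum : π ⟨$⟩ʳ i <ᶠ π ⟨$⟩ʳ j → NewMinimum s i j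
    ascent⇒newMinimum πi<πj with newMinimum? s i j
    ... | yes ij = ij
    ... | no ¬ij = ⊥-elim (FP.<-asym πi<πj (π-monotone (inj₂ (i<j , ¬ij))))

  π-avoids : Avoids132 π
  π-avoids (a , b , c , a<b , b<c , πa<πc , πc<πb) = FP.<-asym πc<πb
    (Equivalence.from (π-ascent⇔newMinimum b<c)
      (newMinimum-shrink s (<⇒≤ a<b)
        (Equivalence.to (π-ascent⇔newMinimum (FP.<-trans a<b b<c)) πa<πc)))

  π-rank : IsRankSeq π s
  π-rank = isRankSeq-intro (proj₁ s∈S) decreasing next
    where
    decreasing : ∀ {i j} → Ascent π i j → s j < s i
    decreasing (i<j , πi<πj) = Equivalence.to (π-ascent⇔newMinimum i<j) πi<πj _ ≤-refl i<j
    next : ∀ {i} → 2 ≤ s i → ∃ λ j → Ascent π i j × s i ≤ suc (s j)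
    next 2≤si with first-drop s∈S 2≤si
    ... | j , i<j , ij , si≤ = j , (i<j , Equivalence.from (π-ascent⇔newMinimum i<j) ij) , si≤

rankSeq-surjective : {s : Fin n → ℕ} → InS n s →
  Σ (Permutation′ n) λ p → Avoids132 p × IsRankSeq p s
rankSeq-surjective s∈S = π , π-avoids , π-rank
  where open Construction s∈S

lemma2 : (n : ℕ) →
    -- R is a well-defined map Av_n(132) → 𝒮_n
    ((p : Permutation′ n) → Avoids132 p →
      Σ (Fin n → ℕ) λ s → IsRankSeq p s × InS n s) ×
    -- R is injective on Av_n(132)
    ((p q : Permutation′ n) → Avoids132 p → Avoids132 q →
      (s : Fin n → ℕ) → IsRankSeq p s → IsRankSeq q s →
      ∀ i → p ⟨$⟩ʳ i ≡ q ⟨$⟩ʳ i) ×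
    -- R is surjective onto 𝒮_n
    ((s : Fin n → ℕ) → InS n s →
      Σ (Permutation′ n) λ p → Avoids132 p × IsRankSeq p s)
lemma2 n =
  (λ p p-avoids → let s , rank = rankSeq-exists p in s , rank , Avoider.rankSeq∈S p-avoids rank) ,
  (λ p q p-avoids q-avoids s → rankSeq-injective p-avoids q-avoids) ,
  (λ s → rankSeq-surjective)
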